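{- Let $n\ge 2$, let $A\in\mathcal S(K_n)$, and let $G$ be the graph on vertex set $\{1,\dots,n+2\}$ obtained from the complete graph $K_n$ on $\{1,\dots,n\}$ by adding two new vertices $n+1$ and $n+2$, each adjacent only to vertex $n$ (so $G$ is obtained from the lollipop graph $L_{n,1}$ by duplicating its pendant vertex without an edge). Let $\mu_1\neq\mu_2$ be real numbers, let $\mathbf e_n\in\mathbb R^n$ be the $n$th standard basis vector, and let $$B=\begin{bmatrix} A & \mathbf e_n & \mathbf e_n\\ \mathbf e_n^T & \mu_1 & 0\\ \mathbf e_n^T & 0 & \mu_2\end{bmatrix}\in\mathcal S(G).$$ Then $B$ has the Strong Spectral Property.
   Context: For a simple graph $G$ on vertex set $\{1,\dots,N\}$, $\mathcal S(G)$ is the set of real symmetric $N\times N$ matrices whose $(i,j)$ entry for $i\ne j$ is nonzero iff $ij\in E(G)$. A real symmetric matrix $B$ has the Strong Spectral Property (SSP) if the only real symmetric matrix $X$ with $B\circ X=O$ (entrywise product), $I\circ X=O$ and $BX=XB$ is $X=O$. -}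

module Defs where

open import Level using (Level; _⊔_) renaming (suc to lsuc)
open import Data.Nat as ℕ using (ℕ; zero; suc)
open import Data.Fin using (Fin; zero; suc; toℕ; splitAt)
open import Data.Sum using (_⊎_; inj₁; inj₂)
open import Data.Product using (Σ; ∃; _×_; _,_)
open import Relation.Nullary using (¬_; yes; no)
open import Relation.Binary.PropositionalEquality using (_≡_)
open import Algebra.Bundles using (CommutativeRing)

-- The real numbers, axiomatised as a complete ordered field.
-- (agda-stdlib has no reals; every model of this record is, classically,
-- isomorphic to ℝ.)

record RealField c ℓ : Set (lsuc (c ⊔ ℓ)) where
  field
    commRing : CommutativeRing c ℓ
  open CommutativeRing commRing public using (Carrier; _≈_; _+_; _*_; -_; 0#; 1#)
  field
    0≉1     : ¬ (0# ≈ 1#)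
    _⁻¹     : Carrier → Carrier
    ⁻¹-inverse : ∀ x → ¬ (x ≈ 0#) → (x * (x ⁻¹)) ≈ 1#
    _≤_        : Carrier → Carrier → Set ℓ
    ≤-refl     : ∀ {x y} → x ≈ y → x ≤ y
    ≤-antisym  : ∀ {x y} → x ≤ y → y ≤ x → x ≈ y
    ≤-trans    : ∀ {x y z} → x ≤ y → y ≤ z → x ≤ z
    ≤-total    : ∀ x y → (x ≤ y) ⊎ (y ≤ x)
    ≤-resp-≈   : ∀ {x x′ y y′} → x ≈ x′ → y ≈ y′ → x ≤ y → x′ ≤ y′
    +-mono-≤   : ∀ {x y} z → x ≤ y → (x + z) ≤ (y + z)
    *-nonneg   : ∀ {x y} → 0# ≤ x → 0# ≤ y → 0# ≤ (x * y)
    sup : (P : Carrier → Set c) → (Σ Carrier P) →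
          (Σ Carrier λ b → ∀ x → P x → x ≤ b) →
          Σ Carrier λ s → (∀ x → P x → x ≤ s) ×
                          (∀ b → (∀ x → P x → x ≤ b) → s ≤ b)

-- Graphs on vertex set Fin N (vertex i+1 of the paper is Fin index i).

record Graph (N : ℕ) : Set₁ where
  field
    Adj     : Fin N → Fin N → Set
    sym     : ∀ {i j} → Adj i j → Adj j i
    irrefl  : ∀ {i} → ¬ Adj i i

K : (n : ℕ) → Graph n
K n = record { Adj = λ i j → ¬ (i ≡ j)
             ; sym = λ p q → p (Relation.Binary.PropositionalEquality.sym q)
             ; irrefl = λ p → p Relation.Binary.PropositionalEquality.refl }

-- The graph G on Fin (n + 2): K_n on the first n vertices, plus two new
-- vertices (paper: n+1, n+2), each adjacent only to the paper's vertex n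
-- (Fin index n-1).
data GAdj (n : ℕ) : Fin (n ℕ.+ 2) → Fin (n ℕ.+ 2) → Set where
  old : ∀ {i j} (a b : Fin n) → splitAt n i ≡ inj₁ a → splitAt n j ≡ inj₁ b →
        ¬ (a ≡ b) → GAdj n i j
  new→n : ∀ {i j} (a : Fin n) (k : Fin 2) → splitAt n i ≡ inj₂ k →
          splitAt n j ≡ inj₁ a → suc (toℕ a) ≡ n → GAdj n i j
  n→new : ∀ {i j} (a : Fin n) (k : Fin 2) → splitAt n i ≡ inj₁ a →
          splitAt n j ≡ inj₂ k → suc (toℕ a) ≡ n → GAdj n i j

module Matrices {c ℓ} (R : RealField c ℓ) where
  open RealField R using (Carrier; _≈_; _+_; _*_; 0#; 1#)

  Matrix : ℕ → Set c
  Matrix N = Fin N → Fin N → Carrier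

  ∑ : ∀ {N} → (Fin N → Carrier) → Carrier
  ∑ {zero}  f = 0#
  ∑ {suc N} f = f zero + ∑ (λ i → f (suc i))

  _·_ : ∀ {N} → Matrix N → Matrix N → Matrix N
  (M · P) i j = ∑ (λ k → M i k * P k j)

  _∘ₕ_ : ∀ {N} → Matrix N → Matrix N → Matrix N
  (M ∘ₕ P) i j = M i j * P i j

  I : ∀ {N} → Matrix N
  I i j with i Data.Fin.≟ j
  ... | yes _ = 1#
  ... | no  _ = 0#

  O : ∀ {N} → Matrix N
  O i j = 0#

  _≈ₘ_ : ∀ {N} → Matrix N → Matrix N → Set ℓ
  M ≈ₘ P = ∀ i j → M i j ≈ P i j

  Symmetric : ∀ {N} → Matrix N → Set ℓ
  Symmetric M = ∀ i j → M i j ≈ M j i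

  InS : ∀ {N} → Graph N → Matrix N → Set (ℓ Level.⊔ Level.zero)
  InS {N} G M = Symmetric M ×
    (∀ i j → ¬ (i ≡ j) →
       ((¬ (M i j ≈ 0#) → Graph.Adj G i j) × (Graph.Adj G i j → ¬ (M i j ≈ 0#))))

  SSP : ∀ {N} → Matrix N → Set (c ⊔ ℓ)
  SSP {N} M = (X : Matrix N) → Symmetric X → (M ∘ₕ X) ≈ₘ O → (I ∘ₕ X) ≈ₘ O →
              (M · X) ≈ₘ (X · M) → X ≈ₘ O

  -- standard basis vector e_n ∈ ℝⁿ (1 at Fin index n-1)
  eLast : ∀ {n} → Fin n → Carrier
  eLast {n} a with suc (toℕ a) ℕ.≟ n
  ... | yes _ = 1#
  ... | no  _ = 0#

  blockB : ∀ {n} → Matrix n → Carrier → Carrier → Matrix (n ℕ.+ 2)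
  blockB {n} A μ₁ μ₂ i j with splitAt n i | splitAt n j
  ... | inj₁ a | inj₁ b = A a b
  ... | inj₁ a | inj₂ _ = eLast a
  ... | inj₂ _ | inj₁ b = eLast b
  ... | inj₂ zero | inj₂ zero = μ₁
  ... | inj₂ (suc zero) | inj₂ (suc zero) = μ₂
  ... | inj₂ zero | inj₂ (suc zero) = 0#
  ... | inj₂ (suc zero) | inj₂ zero = 0#

{-# OPTIONS --safe #-}

-- Since every
-- off-diagonal *-congʳ-≡ of A and the n-th *-congʳ-≡ of eₙ are nonzero, X has the shape
-- [[O, x, y], [xᵀ, 0, z], [yᵀ, z, 0]] with xₙ = yₙ = 0.  Comparing entries of BX
-- and XB gives μ₁ z = μ₂ z, A x = μ₁ x, A y = μ₂ y (entries (i, n+1), (i, n+2))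
-- and x + y = 0 (row n).  Hence z = 0, and A x = -A y = μ₂ x, so μ₁ x = μ₂ x and
-- x = y = 0.

module Submission where

open import Defs
open import Level using (Level)
open import Data.Nat as ℕ using (ℕ; _≤_; suc; s≤s)
open import Relation.Nullary using (¬_)

open import Data.Fin using (Fin; zero; suc; toℕ; splitAt; _↑ˡ_; _↑ʳ_; fromℕ; _≟_)
open import Data.Fin.Properties using (splitAt-↑ˡ; splitAt-↑ʳ; splitAt⁻¹-↑ˡ; splitAt⁻¹-↑ʳ; toℕ-fromℕ)
open import Data.Sum using (inj₁; inj₂)
open import Data.Product using (_,_; proj₂)
open import Relation.Nullary using (yes; no; contradiction)
open import Relation.Binary.PropositionalEquality as ≡ using (_≡_; cong)
open import Algebra.Bundles using (CommutativeRing)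

module _ {c ℓ} (R : RealField c ℓ) where
  open RealField R using (Carrier; _≈_; _+_; _*_; -_; 0#; 1#; commRing; 0≉1; _⁻¹; ⁻¹-inverse)
  open CommutativeRing commRing
    using (setoid; ring; refl; sym; trans; reflexive; +-cong; *-congˡ; *-congʳ; -‿cong; _-_;
           +-assoc; +-identityˡ; +-identityʳ; *-assoc; *-comm; *-identityˡ; zeroˡ; zeroʳ; -‿inverseʳ)
  open import Algebra.Properties.Ring ring
    using (-‿distribʳ-*; -‿+-comm; -0#≈0#; -‿injective; +-inverseʳ-unique; [y-z]x≈yx-zx)
  open import Relation.Binary.Reasoning.Setoid setoid
  open Matrices R

  x≈0⇒x*y≈0 : ∀ {x y} → x ≈ 0# → x * y ≈ 0#
  x≈0⇒x*y≈0 x≈0 = trans (*-congʳ x≈0) (zeroˡ _)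

  y≈0⇒x*y≈0 : ∀ {x y} → y ≈ 0# → x * y ≈ 0#
  y≈0⇒x*y≈0 y≈0 = trans (*-congˡ y≈0) (zeroʳ _)

  *-congʳ-≡ : ∀ {x y z} → x ≡ y → x * z ≈ y * z
  *-congʳ-≡ x≡y = *-congʳ (reflexive x≡y)

  *-congˡ-≡ : ∀ {x y z} → y ≡ z → x * y ≈ x * z
  *-congˡ-≡ y≡z = *-congˡ (reflexive y≡z)

  xy≈0⇒y≈0 : ∀ {x y} → ¬ (x ≈ 0#) → x * y ≈ 0# → y ≈ 0#
  xy≈0⇒y≈0 {x} {y} x≉0 xy≈0 = begin
    y                 ≈⟨ *-identityˡ y ⟨
    1# * y            ≈⟨ *-congʳ (⁻¹-inverse x x≉0) ⟨
    (x * x ⁻¹) * y    ≈⟨ *-congʳ (*-comm x (x ⁻¹)) ⟩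
    (x ⁻¹ * x) * y    ≈⟨ *-assoc (x ⁻¹) x y ⟩
    x ⁻¹ * (x * y)    ≈⟨ *-congˡ xy≈0 ⟩
    x ⁻¹ * 0#         ≈⟨ zeroʳ _ ⟩
    0#                ∎

  xz≈yz⇒z≈0 : ∀ {x y z} → ¬ (x ≈ y) → x * z ≈ y * z → z ≈ 0#
  xz≈yz⇒z≈0 {x} {y} {z} x≉y xz≈yz = xy≈0⇒y≈0 x-y≉0 (begin
    (x - y) * z       ≈⟨ [y-z]x≈yx-zx z x y ⟩
    x * z - y * z     ≈⟨ +-cong xz≈yz refl ⟩
    y * z - y * z     ≈⟨ -‿inverseʳ _ ⟩
    0#                ∎)
    where
    x-y≉0 : ¬ ((x - y) ≈ 0#)
    x-y≉0 x-y≈0 = x≉y (sym (-‿injective (+-inverseʳ-unique x (- y) x-y≈0)))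

  ∑-cong : ∀ {N} {f g : Fin N → Carrier} → (∀ i → f i ≈ g i) → ∑ f ≈ ∑ g
  ∑-cong {ℕ.zero}  f≈g = refl
  ∑-cong {suc N} f≈g = +-cong (f≈g zero) (∑-cong (λ i → f≈g (suc i)))

  ∑-≈0 : ∀ {N} {f : Fin N → Carrier} → (∀ i → f i ≈ 0#) → ∑ f ≈ 0#
  ∑-≈0 {ℕ.zero}  f≈0 = refl
  ∑-≈0 {suc N} f≈0 = trans (+-cong (f≈0 zero) (∑-≈0 (λ i → f≈0 (suc i)))) (+-identityˡ 0#)

  ∑-neg : ∀ {N} (f : Fin N → Carrier) → ∑ (λ i → - f i) ≈ - ∑ f
  ∑-neg {ℕ.zero}  f = sym -0#≈0#
  ∑-neg {suc N} f = trans (+-cong refl (∑-neg (λ i → f (suc i)))) (-‿+-comm _ _)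

  ∑-++ : ∀ m n (f : Fin (m ℕ.+ n) → Carrier) →
         ∑ f ≈ ∑ (λ a → f (a ↑ˡ n)) + ∑ (λ k → f (m ↑ʳ k))
  ∑-++ ℕ.zero    n f = sym (+-identityˡ _)
  ∑-++ (suc m) n f = trans (+-cong refl (∑-++ m n (λ i → f (suc i)))) (sym (+-assoc _ _ _))

  _·ᵥ_ : ∀ {n} → Matrix n → (Fin n → Carrier) → Fin n → Carrier
  (A ·ᵥ x) a = ∑ (λ b → A a b * x b)

  IsEigenvector : ∀ {n} → Matrix n → Carrier → (Fin n → Carrier) → Set ℓ
  IsEigenvector A μ x = ∀ a → (A ·ᵥ x) a ≈ μ * x a

  ·ᵥ-neg : ∀ {n} (A : Matrix n) (x : Fin n → Carrier) a → (A ·ᵥ (λ b → - x b)) a ≈ - (A ·ᵥ x) a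
  ·ᵥ-neg A x a = trans (∑-cong (λ b → sym (-‿distribʳ-* (A a b) (x b)))) (∑-neg (λ b → A a b * x b))

  opposite-eigenvectors≈0 : ∀ {n} {A : Matrix n} {μ₁ μ₂} {x y : Fin n → Carrier} → ¬ (μ₁ ≈ μ₂) →
                            IsEigenvector A μ₁ x → IsEigenvector A μ₂ y → (∀ b → x b + y b ≈ 0#) →
                            ∀ a → x a ≈ 0#
  opposite-eigenvectors≈0 {A = A} {μ₁} {μ₂} {x} {y} μ₁≉μ₂ Ax≈μ₁x Ay≈μ₂y x+y≈0 a =
    xz≈yz⇒z≈0 μ₁≉μ₂ (-‿injective (begin
      - (μ₁ * x a)                   ≈⟨ -‿cong (Ax≈μ₁x a) ⟨
      - (A ·ᵥ x) a                   ≈⟨ ·ᵥ-neg A x a ⟨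
      (A ·ᵥ (λ b → - x b)) a         ≈⟨ ∑-cong (λ b → *-congˡ (sym (y≈-x b))) ⟩
      (A ·ᵥ y) a                     ≈⟨ Ay≈μ₂y a ⟩
      μ₂ * y a                       ≈⟨ *-congˡ (y≈-x a) ⟩
      μ₂ * - x a                     ≈⟨ -‿distribʳ-* μ₂ (x a) ⟨
      - (μ₂ * x a)                   ∎))
    where
    y≈-x : ∀ b → y b ≈ - x b
    y≈-x b = +-inverseʳ-unique (x b) (y b) (x+y≈0 b)

  I-diag : ∀ {N} (i : Fin N) → I i i ≡ 1#
  I-diag i with i ≟ i
  ... | yes _  = ≡.refl
  ... | no i≢i = contradiction ≡.refl i≢i

  eLast-last : ∀ {n} (a : Fin n) → suc (toℕ a) ≡ n → eLast a ≡ 1#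
  eLast-last {n} a a-last with suc (toℕ a) ℕ.≟ n
  ... | yes _     = ≡.refl
  ... | no ¬a-last = contradiction a-last ¬a-last

  module BlockIndices (n : ℕ) where

    orig : Fin n → Fin (n ℕ.+ 2)
    orig a = a ↑ˡ 2

    new₁ new₂ : Fin (n ℕ.+ 2)
    new₁ = n ↑ʳ zero
    new₂ = n ↑ʳ suc zero

    data BlockIndex : Fin (n ℕ.+ 2) → Set where
      orig-index  : ∀ a → BlockIndex (orig a)
      new₁-index : BlockIndex new₁
      new₂-index : BlockIndex new₂

    blockIndex : ∀ i → BlockIndex i
    blockIndex i with splitAt n i in eq
    ... | inj₁ a          = ≡.subst BlockIndex (splitAt⁻¹-↑ˡ eq) (orig-index a)
    ... | inj₂ zero       = ≡.subst BlockIndex (splitAt⁻¹-↑ʳ eq) new₁-index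
    ... | inj₂ (suc zero) = ≡.subst BlockIndex (splitAt⁻¹-↑ʳ eq) new₂-index

    blockSum : Matrix (n ℕ.+ 2) → Matrix (n ℕ.+ 2) → Fin (n ℕ.+ 2) → Fin (n ℕ.+ 2) → Carrier
    blockSum M P i j = (∑ (λ b → M i (orig b) * P (orig b) j) + M i new₁ * P new₁ j) + M i new₂ * P new₂ j

    ·≈blockSum : ∀ M P i j → (M · P) i j ≈ blockSum M P i j
    ·≈blockSum M P i j = trans (∑-++ n 2 (λ k → M i k * P k j))
                           (trans (+-cong refl (+-cong refl (+-identityʳ _))) (sym (+-assoc _ _ _)))

    module _ {A : Matrix n} {μ₁ μ₂ : Carrier} where
      private B = blockB A μ₁ μ₂

      blockB-orig-orig : ∀ a b → B (orig a) (orig b) ≡ A a b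
      blockB-orig-orig a b rewrite splitAt-↑ˡ n a 2 | splitAt-↑ˡ n b 2 = ≡.refl

      blockB-orig-new₁ : ∀ a → B (orig a) new₁ ≡ eLast a
      blockB-orig-new₁ a rewrite splitAt-↑ˡ n a 2 | splitAt-↑ʳ n 2 zero = ≡.refl

      blockB-orig-new₂ : ∀ a → B (orig a) new₂ ≡ eLast a
      blockB-orig-new₂ a rewrite splitAt-↑ˡ n a 2 | splitAt-↑ʳ n 2 (suc zero) = ≡.refl

      blockB-new₁-orig : ∀ a → B new₁ (orig a) ≡ eLast a
      blockB-new₁-orig a rewrite splitAt-↑ˡ n a 2 | splitAt-↑ʳ n 2 zero = ≡.refl

      blockB-new₂-orig : ∀ a → B new₂ (orig a) ≡ eLast a
      blockB-new₂-orig a rewrite splitAt-↑ˡ n a 2 | splitAt-↑ʳ n 2 (suc zero) = ≡.refl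

      blockB-new₁-new₁ : B new₁ new₁ ≡ μ₁
      blockB-new₁-new₁ rewrite splitAt-↑ʳ n 2 zero = ≡.refl

      blockB-new₁-new₂ : B new₁ new₂ ≡ 0#
      blockB-new₁-new₂ rewrite splitAt-↑ʳ n 2 zero | splitAt-↑ʳ n 2 (suc zero) = ≡.refl

      blockB-new₂-new₁ : B new₂ new₁ ≡ 0#
      blockB-new₂-new₁ rewrite splitAt-↑ʳ n 2 zero | splitAt-↑ʳ n 2 (suc zero) = ≡.refl

      blockB-new₂-new₂ : B new₂ new₂ ≡ μ₂
      blockB-new₂-new₂ rewrite splitAt-↑ʳ n 2 (suc zero) = ≡.refl

  sum₃-first : ∀ {s s′ a b} → s ≈ s′ → a ≈ 0# → b ≈ 0# → (s + a) + b ≈ s′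
  sum₃-first s≈s′ a≈0 b≈0 = trans (+-cong (+-cong s≈s′ a≈0) b≈0) (trans (+-identityʳ _) (+-identityʳ _))

  sum₃-second : ∀ {s a a′ b} → s ≈ 0# → a ≈ a′ → b ≈ 0# → (s + a) + b ≈ a′
  sum₃-second s≈0 a≈a′ b≈0 = trans (+-cong (+-cong s≈0 a≈a′) b≈0) (trans (+-identityʳ _) (+-identityˡ _))

  sum₃-third : ∀ {s a b b′} → s ≈ 0# → a ≈ 0# → b ≈ b′ → (s + a) + b ≈ b′
  sum₃-third s≈0 a≈0 b≈b′ = trans (+-cong (+-cong s≈0 a≈0) b≈b′) (trans (+-cong (+-identityˡ 0#) refl) (+-identityˡ _))

  sum₃-last-two : ∀ {s a a′ b b′} → s ≈ 0# → a ≈ a′ → b ≈ b′ → (s + a) + b ≈ a′ + b′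
  sum₃-last-two s≈0 a≈a′ b≈b′ = +-cong (trans (+-cong s≈0 a≈a′) (+-identityˡ _)) b≈b′

  module SSP-blockB {n : ℕ} {A : Matrix n} (A-offdiag≉0 : ∀ a b → ¬ (a ≡ b) → ¬ (A a b ≈ 0#))
                    {μ₁ μ₂ : Carrier} (μ₁≉μ₂ : ¬ (μ₁ ≈ μ₂))
                    (last : Fin n) (last-is-last : suc (toℕ last) ≡ n)
                    {X : Matrix (n ℕ.+ 2)} (X-sym : Symmetric X)
                    (B∘X≈O : (blockB A μ₁ μ₂ ∘ₕ X) ≈ₘ O) (I∘X≈O : (I ∘ₕ X) ≈ₘ O)
                    (BX≈XB : (blockB A μ₁ μ₂ · X) ≈ₘ (X · blockB A μ₁ μ₂)) where
    open BlockIndices n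

    private
      B : Matrix (n ℕ.+ 2)
      B = blockB A μ₁ μ₂

    x y : Fin n → Carrier
    x a = X (orig a) new₁
    y a = X (orig a) new₂

    z : Carrier
    z = X new₁ new₂

    B∘X≈O-at : ∀ i j {b} → B i j ≡ b → b * X i j ≈ 0#
    B∘X≈O-at i j B≡b = trans (*-congʳ-≡ (≡.sym B≡b)) (B∘X≈O i j)

    X-diag≈0 : ∀ i → X i i ≈ 0#
    X-diag≈0 i = trans (sym (*-identityˡ _)) (trans (*-congʳ-≡ (≡.sym (I-diag i))) (I∘X≈O i i))

    X-orig≈0 : ∀ a b → X (orig a) (orig b) ≈ 0#
    X-orig≈0 a b with a ≟ b
    ... | yes ≡.refl = X-diag≈0 (orig a)
    ... | no a≢b    = xy≈0⇒y≈0 (A-offdiag≉0 a b a≢b)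
                        (B∘X≈O-at (orig a) (orig b) (blockB-orig-orig a b))

    eLast*x≈0 : ∀ a → eLast a * x a ≈ 0#
    eLast*x≈0 a = B∘X≈O-at (orig a) new₁ (blockB-orig-new₁ a)

    eLast*y≈0 : ∀ a → eLast a * y a ≈ 0#
    eLast*y≈0 a = B∘X≈O-at (orig a) new₂ (blockB-orig-new₂ a)

    eLast-last≉0 : ¬ (eLast last ≈ 0#)
    eLast-last≉0 eLast≈0 = 0≉1 (sym (trans (reflexive (≡.sym (eLast-last last last-is-last))) eLast≈0))

    x-last≈0 : x last ≈ 0#
    x-last≈0 = xy≈0⇒y≈0 eLast-last≉0 (eLast*x≈0 last)

    y-last≈0 : y last ≈ 0#
    y-last≈0 = xy≈0⇒y≈0 eLast-last≉0 (eLast*y≈0 last)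

    commute-at : ∀ i j {l r} → blockSum B X i j ≈ l → blockSum X B i j ≈ r → l ≈ r
    commute-at i j {l} {r} BX≈l XB≈r = begin
      l                ≈⟨ BX≈l ⟨
      blockSum B X i j ≈⟨ ·≈blockSum B X i j ⟨
      (B · X) i j      ≈⟨ BX≈XB i j ⟩
      (X · B) i j      ≈⟨ ·≈blockSum X B i j ⟩
      blockSum X B i j ≈⟨ XB≈r ⟩
      r                ∎

    z≈0 : z ≈ 0#
    z≈0 = xz≈yz⇒z≈0 μ₁≉μ₂ (commute-at new₁ new₂
      (sum₃-second (∑-≈0 λ b → trans (*-congʳ-≡ (blockB-new₁-orig b)) (eLast*y≈0 b))
                   (*-congʳ-≡ blockB-new₁-new₁)
                   (x≈0⇒x*y≈0 (reflexive blockB-new₁-new₂)))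
      (sum₃-third (∑-≈0 λ b → trans (*-comm _ _) (trans (*-congʳ-≡ (blockB-orig-new₂ b))
                                                 (trans (*-congˡ (X-sym new₁ (orig b))) (eLast*x≈0 b))))
                  (y≈0⇒x*y≈0 (reflexive blockB-new₁-new₂))
                  (trans (*-congˡ-≡ blockB-new₂-new₂) (*-comm _ _))))

    x-eigen : IsEigenvector A μ₁ x
    x-eigen a = commute-at (orig a) new₁
      (sum₃-first (∑-cong λ b → *-congʳ-≡ (blockB-orig-orig a b))
                  (y≈0⇒x*y≈0 (X-diag≈0 new₁))
                  (y≈0⇒x*y≈0 (trans (X-sym new₂ new₁) z≈0)))
      (sum₃-second (∑-≈0 λ b → x≈0⇒x*y≈0 (X-orig≈0 a b))
                   (trans (*-congˡ-≡ blockB-new₁-new₁) (*-comm _ _))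
                   (y≈0⇒x*y≈0 (reflexive blockB-new₂-new₁)))

    y-eigen : IsEigenvector A μ₂ y
    y-eigen a = commute-at (orig a) new₂
      (sum₃-first (∑-cong λ b → *-congʳ-≡ (blockB-orig-orig a b))
                  (y≈0⇒x*y≈0 z≈0)
                  (y≈0⇒x*y≈0 (X-diag≈0 new₂)))
      (sum₃-third (∑-≈0 λ b → x≈0⇒x*y≈0 (X-orig≈0 a b))
                  (y≈0⇒x*y≈0 (reflexive blockB-new₁-new₂))
                  (trans (*-congˡ-≡ blockB-new₂-new₂) (*-comm _ _)))

    x+y≈0 : ∀ b → x b + y b ≈ 0#
    x+y≈0 b = commute-at (orig last) (orig b)
      (sum₃-last-two (∑-≈0 λ c → y≈0⇒x*y≈0 (X-orig≈0 c b))
                     (from-last-row new₁ (blockB-orig-new₁ last))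
                     (from-last-row new₂ (blockB-orig-new₂ last)))
      (sum₃-first (∑-≈0 λ c → x≈0⇒x*y≈0 (X-orig≈0 last c))
                  (x≈0⇒x*y≈0 x-last≈0)
                  (x≈0⇒x*y≈0 y-last≈0))
      where
      from-last-row : ∀ k → B (orig last) k ≡ eLast last → B (orig last) k * X k (orig b) ≈ X (orig b) k
      from-last-row k B≡eLast = begin
        B (orig last) k * X k (orig b) ≈⟨ *-congʳ-≡ (≡.trans B≡eLast (eLast-last last last-is-last)) ⟩
        1# * X k (orig b)              ≈⟨ *-identityˡ _ ⟩
        X k (orig b)                   ≈⟨ X-sym k (orig b) ⟩
        X (orig b) k                   ∎

    x≈0 : ∀ a → x a ≈ 0#
    x≈0 = opposite-eigenvectors≈0 μ₁≉μ₂ x-eigen y-eigen x+y≈0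

    y≈0 : ∀ a → y a ≈ 0#
    y≈0 a = trans (+-inverseʳ-unique (x a) (y a) (x+y≈0 a)) (trans (-‿cong (x≈0 a)) -0#≈0#)

    X≈O : X ≈ₘ O
    X≈O i j with blockIndex i | blockIndex j
    ... | orig-index a | orig-index b = X-orig≈0 a b
    ... | orig-index a | new₁-index   = x≈0 a
    ... | orig-index a | new₂-index   = y≈0 a
    ... | new₁-index   | orig-index b = trans (X-sym _ _) (x≈0 b)
    ... | new₁-index   | new₁-index   = X-diag≈0 new₁
    ... | new₁-index   | new₂-index   = z≈0
    ... | new₂-index   | orig-index b = trans (X-sym _ _) (y≈0 b)
    ... | new₂-index   | new₁-index   = trans (X-sym _ _) z≈0
    ... | new₂-index   | new₂-index   = X-diag≈0 new₂

blockB-SSP : ∀ {c ℓ} (R : RealField c ℓ) {n : ℕ} (last : Fin n) → suc (toℕ last) ≡ n →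
             let open RealField R in
             let open Matrices R in
             (A : Matrix n) → (∀ a b → ¬ (a ≡ b) → ¬ (A a b ≈ 0#)) →
             (μ₁ μ₂ : Carrier) → ¬ (μ₁ ≈ μ₂) → SSP (blockB A μ₁ μ₂)
blockB-SSP R last last-is-last A A-offdiag≉0 μ₁ μ₂ μ₁≉μ₂ X X-sym B∘X≈O I∘X≈O BX≈XB =
  SSP-blockB.X≈O R A-offdiag≉0 μ₁≉μ₂ last last-is-last X-sym B∘X≈O I∘X≈O BX≈XB

mainTheorem4 : ∀ {c ℓ : Level} (R : RealField c ℓ) (n : ℕ) → 2 ≤ n →
    let open RealField R in
    let open Matrices R in
    (A : Matrix n) → InS (K n) A →
    (μ₁ μ₂ : Carrier) → ¬ (μ₁ ≈ μ₂) →
    SSP (blockB A μ₁ μ₂)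
mainTheorem4 R (suc m) (s≤s _) A (_ , A-pattern) =
  blockB-SSP R (fromℕ m) (cong suc (toℕ-fromℕ m)) A (λ a b a≢b → proj₂ (A-pattern a b a≢b) a≢b)
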